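{- Let $n\ge 5$ and $2\le r\le n+1$, and let $S$ be a subgraph of $FQ_n$ isomorphic to the star $K_{1,r}$. If $C$ is a connected subgraph of $FQ_n-V(S)$ with $k=|V(C)|\ge 2$, then $|N_{FQ_n}(V(C))\cap V(S)|\le 2(k-1)$, and equality holds only if $C$ is a star.
   Context: The $n$-dimensional hypercube $Q_n$ has as vertices all binary strings of length $n$, two strings being adjacent iff they differ in exactly one position. The folded hypercube $FQ_n$ is obtained from $Q_n$ by adding, for every vertex $u=u_1\cdots u_n$, the edge between $u$ and its complement $\bar u=\bar u_1\cdots\bar u_n$ (where $\bar u_i=1-u_i$). $K_{1,r}$ denotes the star with $r$ leaves. For a vertex set $A$ of a graph $G$, $N_G(A)=\bigcup_{x\in A}N_G(x)\setminus A$, where $N_G(x)$ is the set of neighbors of $x$. -}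

module Defs where

open import Data.Bool using (Bool; not; true; false)
open import Data.Nat using (ℕ; zero; suc; _+_)
open import Data.Vec using (Vec; []; _∷_; map)
open import Data.List using (List; []; _∷_; length; filter)
open import Data.List.Membership.Propositional using (_∈_; _∉_)
open import Data.List.Relation.Unary.All using (All)
open import Data.List.Relation.Unary.Any using (Any; any?)
open import Data.List.Relation.Unary.Unique.Propositional using (Unique)
open import Data.Product using (Σ; _×_; _,_; ∃-syntax)
open import Data.Sum using (_⊎_)
open import Relation.Nullary using (Dec; ¬_)
open import Relation.Nullary.Decidable using (_⊎-dec_)
open import Relation.Binary.PropositionalEquality using (_≡_; _≢_)
import Data.Nat.Properties as ℕP
import Data.Vec.Properties as VP
import Data.Bool.Properties as BP

Vertex : ℕ → Set
Vertex n = Vec Bool n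

hamming : ∀ {n} → Vertex n → Vertex n → ℕ
hamming [] [] = 0
hamming (true ∷ u) (true ∷ v) = hamming u v
hamming (false ∷ u) (false ∷ v) = hamming u v
hamming (true ∷ u) (false ∷ v) = suc (hamming u v)
hamming (false ∷ u) (true ∷ v) = suc (hamming u v)

complement : ∀ {n} → Vertex n → Vertex n
complement = map not

FQAdj : ∀ {n} → Vertex n → Vertex n → Set
FQAdj u v = (hamming u v ≡ 1) ⊎ (v ≡ complement u)

FQAdj? : ∀ {n} (u v : Vertex n) → Dec (FQAdj u v)
FQAdj? u v = (hamming u v ℕP.≟ 1) ⊎-dec VP.≡-dec BP._≟_ v (complement u)

-- A subgraph S of FQ_n isomorphic to K_{1,r}: a centre and r distinct
-- leaves, each adjacent (in FQ_n) to the centre; its edges are the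
-- centre–leaf edges.
record StarSubgraph (n r : ℕ) : Set where
  field
    centre : Vertex n
    leaves : List (Vertex n)
    leaves-unique : Unique leaves
    leaves-count : length leaves ≡ r
    leaves-adj : All (FQAdj centre) leaves

starVertices : ∀ {n r} → StarSubgraph n r → List (Vertex n)
starVertices S = StarSubgraph.centre S ∷ StarSubgraph.leaves S

EdgeIn : ∀ {n} → List (Vertex n × Vertex n) → Vertex n → Vertex n → Set
EdgeIn E u v = ((u , v) ∈ E) ⊎ ((v , u) ∈ E)

data Reach {n} (E : List (Vertex n × Vertex n)) : Vertex n → Vertex n → Set where
  here : ∀ {u} → Reach E u u
  step : ∀ {u v w} → EdgeIn E u v → Reach E v w → Reach E u w

record Subgraph (n : ℕ) : Set where
  field
    verts : List (Vertex n)
    verts-unique : Unique verts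
    edges : List (Vertex n × Vertex n)
    edges-FQ : All (λ e → FQAdj (Data.Product.proj₁ e) (Data.Product.proj₂ e)) edges
    edges-in : All (λ e → (Data.Product.proj₁ e ∈ verts) × (Data.Product.proj₂ e ∈ verts)) edges

open Subgraph public

Connected : ∀ {n} → Subgraph n → Set
Connected C = ∀ {u v} → u ∈ verts C → v ∈ verts C → Reach (edges C) u v

Avoids : ∀ {n} → Subgraph n → List (Vertex n) → Set
Avoids C A = All (λ x → x ∉ A) (verts C)

IsStar : ∀ {n} → Subgraph n → Set
IsStar C = ∃[ x ] (x ∈ verts C)
  × All (λ e → (Data.Product.proj₁ e ≡ x) ⊎ (Data.Product.proj₂ e ≡ x)) (edges C)
  × (∀ {y} → y ∈ verts C → y ≢ x → EdgeIn (edges C) x y)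

-- |N_{FQ_n}(A) ∩ B| for A, B lists of distinct vertices with A ∩ B = ∅:
-- the number of elements of B adjacent to some vertex of A.
nbrCount : ∀ {n} → List (Vertex n) → List (Vertex n) → ℕ
nbrCount A B = length (filter (λ s → any? (λ c → FQAdj? s c) A) B)

-- Closed walks of odd length in FQ_n have length at least n + 1: along a walk
-- from x, the length dominates, with the same parity, either d(x, y) or 1 + d(x̄, y), since a
-- hypercube edge moves d by one and the complementary edge swaps x with x̄.  So for
-- n ≥ 5 there are no triangles or pentagons, and (comparing Hamming distances 2 and
-- n − 1) two distinct vertices have at most two common neighbours.  Consequently a
-- vertex outside the star S sees at most two vertices of S, and if it sees two
-- (two leaves) then none of its neighbours sees S at all: a neighbour of the
-- centre would be a third common neighbour, a neighbour of a leaf would close a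
-- pentagon.  For a connected C on k ≥ 2 vertices such a weighting sums to at
-- most 2(k − 1), with equality only when C is a star.

module Submission where

open import Algebra.Properties.CommutativeSemigroup using (interchange)
open import Data.Bool using (Bool; true; false)
import Data.Bool.Properties as Bool
open import Data.Empty using (⊥; ⊥-elim)
open import Data.List using (List; []; _∷_; length; filter; map)
open import Data.List.Membership.Propositional using (_∈_; _∉_; find)
open import Data.List.Membership.Propositional.Properties using (∈-filter⁻)
open import Data.List.Properties using (filter-accept; filter-reject; filter-none; filter-≐)
open import Data.List.Relation.Unary.All as All using (All; []; _∷_)
open import Data.List.Relation.Unary.All.Properties using (¬Any⇒All¬)
open import Data.List.Relation.Unary.AllPairs using ([]; _∷_)
open import Data.List.Relation.Unary.Any using (Any; here; there; any?; toSum; fromSum)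
open import Data.List.Relation.Unary.Unique.Propositional using (Unique)
open import Data.List.Relation.Unary.Unique.Propositional.Properties using (filter⁺)
open import Data.Nat using (ℕ; suc; _≤_; _*_; _∸_; _+_; s≤s; s≤s⁻¹; z≤n; _≟_)
open import Data.Nat.ListAction using (sum)
open import Data.Nat.Properties
open import Data.Product using (∃; ∃₂; _×_; _,_; proj₁; proj₂; swap)
open import Data.Sum as Sum using (_⊎_; inj₁; inj₂; [_,_]′)
open import Data.Vec using ([]; _∷_)
open import Data.Vec.Properties using (≡-dec)
open import Function using (_∘_)
open import Relation.Binary.PropositionalEquality
  using (_≡_; _≢_; refl; sym; trans; cong; cong₂; subst; module ≡-Reasoning)
open import Relation.Nullary using (¬_; Dec; does; yes; no; contradiction)
open import Relation.Unary using (Decidable)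
open import Relation.Unary.Properties using (_∪?_)

open import Defs

infix 4 _≤ₑ_

record _≤ₑ_ (m n : ℕ) : Set where
  constructor even-gap
  field
    half : ℕ
    gap  : m + 2 * half ≡ n

≤ₑ-refl : ∀ {m} → m ≤ₑ m
≤ₑ-refl {m} = even-gap 0 (+-identityʳ m)

≤ₑ-trans : ∀ {m n o} → m ≤ₑ n → n ≤ₑ o → m ≤ₑ o
≤ₑ-trans {m} (even-gap s refl) (even-gap t refl) = even-gap (s + t) (begin
  m + 2 * (s + t)      ≡⟨ cong (m +_) (*-distribˡ-+ 2 s t) ⟩
  m + (2 * s + 2 * t)  ≡⟨ +-assoc m (2 * s) (2 * t) ⟨
  m + 2 * s + 2 * t    ∎)
  where open ≡-Reasoning

≤ₑ-suc : ∀ {m n} → m ≤ₑ n → suc m ≤ₑ suc n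
≤ₑ-suc (even-gap t e) = even-gap t (cong suc e)

≤ₑ-2+ : ∀ {m} → m ≤ₑ 2 + m
≤ₑ-2+ {m} = even-gap 1 (+-comm m 2)

≤ₑ⇒≤ : ∀ {m n} → m ≤ₑ n → m ≤ n
≤ₑ⇒≤ {m} (even-gap t refl) = m≤m+n m (2 * t)

0≰ₑodd : ∀ k → ¬ 0 ≤ₑ suc (2 * k)
0≰ₑodd k (even-gap t e) = even≢odd t k e

hamming-refl : ∀ {n} (u : Vertex n) → hamming u u ≡ 0
hamming-refl [] = refl
hamming-refl (true ∷ u) = hamming-refl u
hamming-refl (false ∷ u) = hamming-refl u

hamming-sym : ∀ {n} (u v : Vertex n) → hamming u v ≡ hamming v u
hamming-sym [] [] = refl
hamming-sym (true ∷ u) (true ∷ v) = hamming-sym u v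
hamming-sym (true ∷ u) (false ∷ v) = cong suc (hamming-sym u v)
hamming-sym (false ∷ u) (true ∷ v) = cong suc (hamming-sym u v)
hamming-sym (false ∷ u) (false ∷ v) = hamming-sym u v

hamming≡0⇒≡ : ∀ {n} (u v : Vertex n) → hamming u v ≡ 0 → u ≡ v
hamming≡0⇒≡ [] [] _ = refl
hamming≡0⇒≡ (true ∷ u) (true ∷ v) e = cong (true ∷_) (hamming≡0⇒≡ u v e)
hamming≡0⇒≡ (false ∷ u) (false ∷ v) e = cong (false ∷_) (hamming≡0⇒≡ u v e)

complement-involutive : ∀ {n} (u : Vertex n) → complement (complement u) ≡ u
complement-involutive [] = refl
complement-involutive (b ∷ u) = cong₂ _∷_ (Bool.not-involutive b) (complement-involutive u)

hamming-complement-complement : ∀ {n} (u v : Vertex n) →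
  hamming (complement u) (complement v) ≡ hamming u v
hamming-complement-complement [] [] = refl
hamming-complement-complement (true ∷ u) (true ∷ v) = hamming-complement-complement u v
hamming-complement-complement (true ∷ u) (false ∷ v) = cong suc (hamming-complement-complement u v)
hamming-complement-complement (false ∷ u) (true ∷ v) = cong suc (hamming-complement-complement u v)
hamming-complement-complement (false ∷ u) (false ∷ v) = hamming-complement-complement u v

hamming-complement : ∀ {n} (u v : Vertex n) → hamming u (complement v) + hamming u v ≡ n
hamming-complement [] [] = refl
hamming-complement (true ∷ u) (true ∷ v) = cong suc (hamming-complement u v)
hamming-complement (false ∷ u) (false ∷ v) = cong suc (hamming-complement u v)
hamming-complement (true ∷ u) (false ∷ v) = trans (+-suc _ _) (cong suc (hamming-complement u v))
hamming-complement (false ∷ u) (true ∷ v) = trans (+-suc _ _) (cong suc (hamming-complement u v))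

hamming-complement-self : ∀ {n} (u : Vertex n) → hamming (complement u) u ≡ n
hamming-complement-self u = begin
  hamming (complement u) u                ≡⟨ hamming-sym (complement u) u ⟩
  hamming u (complement u)                ≡⟨ +-identityʳ _ ⟨
  hamming u (complement u) + 0            ≡⟨ cong (hamming u (complement u) +_) (hamming-refl u) ⟨
  hamming u (complement u) + hamming u u  ≡⟨ hamming-complement u u ⟩
  _                                       ∎
  where open ≡-Reasoning

hamming-triangle : ∀ {n} (x y z : Vertex n) → hamming x z ≤ₑ hamming x y + hamming y z
hamming-triangle [] [] [] = ≤ₑ-refl
hamming-triangle (true ∷ x) (true ∷ y) (true ∷ z) = hamming-triangle x y z
hamming-triangle (false ∷ x) (false ∷ y) (false ∷ z) = hamming-triangle x y z
hamming-triangle (true ∷ x) (false ∷ y) (false ∷ z) = ≤ₑ-suc (hamming-triangle x y z)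
hamming-triangle (false ∷ x) (true ∷ y) (true ∷ z) = ≤ₑ-suc (hamming-triangle x y z)
hamming-triangle (true ∷ x) (true ∷ y) (false ∷ z) =
  subst (suc (hamming x z) ≤ₑ_) (sym (+-suc _ _)) (≤ₑ-suc (hamming-triangle x y z))
hamming-triangle (false ∷ x) (false ∷ y) (true ∷ z) =
  subst (suc (hamming x z) ≤ₑ_) (sym (+-suc _ _)) (≤ₑ-suc (hamming-triangle x y z))
hamming-triangle (true ∷ x) (false ∷ y) (true ∷ z) =
  subst (hamming x z ≤ₑ_) (cong suc (sym (+-suc _ _))) (≤ₑ-trans (hamming-triangle x y z) ≤ₑ-2+)
hamming-triangle (false ∷ x) (true ∷ y) (false ∷ z) =
  subst (hamming x z ≤ₑ_) (cong suc (sym (+-suc _ _))) (≤ₑ-trans (hamming-triangle x y z) ≤ₑ-2+)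

-- Odd girth of the folded hypercube

QAdj : ∀ {n} → Vertex n → Vertex n → Set
QAdj u v = hamming u v ≡ 1

FQAdj-sym : ∀ {n} {u v : Vertex n} → FQAdj u v → FQAdj v u
FQAdj-sym {u = u} {v} (inj₁ h) = inj₁ (trans (hamming-sym v u) h)
FQAdj-sym {u = u} (inj₂ refl) = inj₂ (sym (complement-involutive u))

FQAdj-irrefl : ∀ {n} → 1 ≤ n → {u : Vertex n} → ¬ FQAdj u u
FQAdj-irrefl _ {u} (inj₁ h) = contradiction (trans (sym (hamming-refl u)) h) λ ()
FQAdj-irrefl (s≤s _) {true ∷ _} (inj₂ ())
FQAdj-irrefl (s≤s _) {false ∷ _} (inj₂ ())

infixr 5 _◅_

data Walk {n} : Vertex n → Vertex n → ℕ → Set where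
  ε   : ∀ {x} → Walk x x 0
  _◅_ : ∀ {x y z m} → FQAdj x y → Walk y z m → Walk x z (suc m)

-- The two shortest kinds of x–z path in FQ_n: flip the hamming x z differing
-- bits, or take the complementary edge first and flip the remaining ones.
-- Every x–z walk is at least as long as, and of the same parity as, one of them.
CanonicalBound : ∀ {n} → Vertex n → Vertex n → ℕ → Set
CanonicalBound x z m = hamming x z ≤ₑ m ⊎ suc (hamming (complement x) z) ≤ₑ m

walk⇒canonical : ∀ {n} {x z : Vertex n} {m} → Walk x z m → CanonicalBound x z m
walk⇒canonical {x = x} ε = inj₁ (even-gap 0 (trans (+-identityʳ _) (hamming-refl x)))
walk⇒canonical {x = x} {z} (_◅_ {y = y} (inj₁ x~y) w) with walk⇒canonical w
... | inj₁ b = inj₁ (≤ₑ-trans (hamming-triangle x y z)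
                      (subst (λ d → d + _ ≤ₑ _) (sym x~y) (≤ₑ-suc b)))
... | inj₂ b = inj₂ (≤ₑ-suc (≤ₑ-trans (hamming-triangle (complement x) (complement y) z)
                      (subst (λ d → d + _ ≤ₑ _)
                        (sym (trans (hamming-complement-complement x y) x~y)) b)))
walk⇒canonical {x = x} {z} (inj₂ refl ◅ w) with walk⇒canonical w
... | inj₁ b = inj₂ (≤ₑ-suc b)
... | inj₂ b = inj₁ (≤ₑ-trans ≤ₑ-2+
                  (≤ₑ-suc (subst (λ v → suc (hamming v z) ≤ₑ _) (complement-involutive x) b)))

odd-closed-walk-long : ∀ {n} {x : Vertex n} k → Walk x x (suc (2 * k)) → n ≤ 2 * k
odd-closed-walk-long {x = x} k w with walk⇒canonical w
... | inj₁ b = ⊥-elim (0≰ₑodd k (subst (_≤ₑ _) (hamming-refl x) b))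
... | inj₂ b = subst (_≤ 2 * k) (hamming-complement-self x) (s≤s⁻¹ (≤ₑ⇒≤ b))

triangle-free : ∀ {n} → 3 ≤ n → {a b c : Vertex n} →
  FQAdj a b → FQAdj b c → FQAdj c a → ⊥
triangle-free n≥3 p q r = ≤⇒≯ (odd-closed-walk-long 1 (p ◅ q ◅ r ◅ ε)) n≥3

pentagon-free : ∀ {n} → 5 ≤ n → {a b c d e : Vertex n} →
  FQAdj a b → FQAdj b c → FQAdj c d → FQAdj d e → FQAdj e a → ⊥
pentagon-free n≥5 p q r s t = ≤⇒≯ (odd-closed-walk-long 2 (p ◅ q ◅ r ◅ s ◅ t ◅ ε)) n≥5

-- Common neighbours

QAdj-∷ : ∀ {n a b} {u v : Vertex n} → QAdj (a ∷ u) (b ∷ v) →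
  (a ≡ b × QAdj u v) ⊎ (a ≢ b × u ≡ v)
QAdj-∷ {a = true} {true} e = inj₁ (refl , e)
QAdj-∷ {a = false} {false} e = inj₁ (refl , e)
QAdj-∷ {a = true} {false} {u} {v} e = inj₂ ((λ ()) , hamming≡0⇒≡ u v (suc-injective e))
QAdj-∷ {a = false} {true} {u} {v} e = inj₂ ((λ ()) , hamming≡0⇒≡ u v (suc-injective e))

bool-≢-≢⇒≡ : ∀ {a p b : Bool} → a ≢ p → p ≢ b → a ≡ b
bool-≢-≢⇒≡ {true} {true} a≢p _ = contradiction refl a≢p
bool-≢-≢⇒≡ {false} {false} a≢p _ = contradiction refl a≢p
bool-≢-≢⇒≡ {true} {false} {true} _ _ = refl
bool-≢-≢⇒≡ {false} {true} {false} _ _ = refl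
bool-≢-≢⇒≡ {true} {false} {false} _ p≢b = contradiction refl p≢b
bool-≢-≢⇒≡ {false} {true} {true} _ p≢b = contradiction refl p≢b

hypercube-common-neighbours : ∀ {n} {u v : Vertex n} → u ≢ v →
  ∃₂ λ P Q → ∀ {x} → QAdj u x → QAdj x v → x ≡ P ⊎ x ≡ Q
hypercube-common-neighbours {u = []} {[]} u≢v = contradiction refl u≢v
hypercube-common-neighbours {u = a ∷ u} {b ∷ v} u≢v with a Bool.≟ b
... | no a≢b = a ∷ v , b ∷ u , λ { {p ∷ x} ux xv → other-head (QAdj-∷ ux) (QAdj-∷ xv) }
  where
    other-head : ∀ {p x} → (a ≡ p × QAdj u x) ⊎ (a ≢ p × u ≡ x) → (p ≡ b × QAdj x v) ⊎ (p ≢ b × x ≡ v) →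
      p ∷ x ≡ a ∷ v ⊎ p ∷ x ≡ b ∷ u
    other-head (inj₁ (refl , _)) (inj₁ (refl , _)) = contradiction refl a≢b
    other-head (inj₁ (refl , _)) (inj₂ (_ , refl)) = inj₁ refl
    other-head (inj₂ (_ , refl)) (inj₁ (refl , _)) = inj₂ refl
    other-head (inj₂ (a≢p , _)) (inj₂ (p≢b , _)) = contradiction (bool-≢-≢⇒≡ a≢p p≢b) a≢b
... | yes refl with hypercube-common-neighbours (u≢v ∘ cong (a ∷_))
...   | P , Q , common = a ∷ P , a ∷ Q , λ { {p ∷ x} ux xv → same-head (QAdj-∷ ux) (QAdj-∷ xv) }
  where
    same-head : ∀ {p x} → (a ≡ p × QAdj u x) ⊎ (a ≢ p × u ≡ x) → (p ≡ a × QAdj x v) ⊎ (p ≢ a × x ≡ v) →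
      p ∷ x ≡ a ∷ P ⊎ p ∷ x ≡ a ∷ Q
    same-head (inj₁ (refl , ux)) (inj₁ (_ , xv)) = Sum.map (cong (a ∷_)) (cong (a ∷_)) (common ux xv)
    same-head (inj₁ (refl , _)) (inj₂ (a≢a , _)) = contradiction refl a≢a
    same-head (inj₂ (a≢a , _)) (inj₁ (refl , _)) = contradiction refl a≢a
    same-head (inj₂ (_ , refl)) (inj₂ (_ , refl)) = contradiction refl u≢v

common-neighbour-cases : ∀ {n} {u v x : Vertex n} → u ≢ v → FQAdj u x → FQAdj x v →
  (QAdj u x × QAdj x v) ⊎ ((x ≡ complement u ⊎ x ≡ complement v) × hamming u v + 1 ≡ n)
common-neighbour-cases _ (inj₁ ux) (inj₁ xv) = inj₁ (ux , xv)
common-neighbour-cases {u = u} {v} _ (inj₂ refl) (inj₁ xv) = inj₂ (inj₁ refl , (begin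
  hamming u v + 1                               ≡⟨ +-comm (hamming u v) 1 ⟩
  1 + hamming u v                               ≡⟨ cong₂ _+_ (trans (sym xv) (hamming-sym _ v)) (hamming-sym u v) ⟩
  hamming v (complement u) + hamming v u        ≡⟨ hamming-complement v u ⟩
  _                                             ∎))
  where open ≡-Reasoning
common-neighbour-cases {u = u} {x = x} _ (inj₁ ux) (inj₂ refl) =
  inj₂ (inj₂ (sym (complement-involutive x)) ,
        trans (cong (hamming u (complement x) +_) (sym ux)) (hamming-complement u x))
common-neighbour-cases {u = u} u≢v (inj₂ refl) (inj₂ refl) =
  contradiction (sym (complement-involutive u)) u≢v

common-neighbours : ∀ {n} → 4 ≤ n → {u v : Vertex n} → u ≢ v →
  ∃₂ λ P Q → ∀ {x} → FQAdj u x → FQAdj x v → x ≡ P ⊎ x ≡ Q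
common-neighbours {n} n≥4 {u} {v} u≢v with hamming u v + 1 ≟ n
... | yes antipodal = complement u , complement v ,
        λ ux xv → [ ⊥-elim ∘ too-far , proj₁ ]′ (common-neighbour-cases u≢v ux xv)
  where
    too-far : ∀ {x} → QAdj u x × QAdj x v → ⊥
    too-far {x} (ux , xv) = ≤⇒≯ (subst (_≤ 3) antipodal (+-monoˡ-≤ 1 near)) n≥4
      where
        near : hamming u v ≤ 2
        near = ≤ₑ⇒≤ (subst (hamming u v ≤ₑ_) (cong₂ _+_ ux xv) (hamming-triangle u x v))
... | no ¬antipodal with hypercube-common-neighbours u≢v
...   | P , Q , common = P , Q ,
        λ ux xv → [ (λ (ux′ , xv′) → common ux′ xv′) , (λ (_ , e) → contradiction e ¬antipodal) ]′
                    (common-neighbour-cases u≢v ux xv)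

pigeonhole : ∀ {A : Set} {x y z P Q : A} → x ≢ y → x ≢ z → y ≢ z →
  x ≡ P ⊎ x ≡ Q → y ≡ P ⊎ y ≡ Q → z ≡ P ⊎ z ≡ Q → ⊥
pigeonhole x≢y _ _ (inj₁ refl) (inj₁ refl) _ = x≢y refl
pigeonhole x≢y _ _ (inj₂ refl) (inj₂ refl) _ = x≢y refl
pigeonhole _ x≢z _ (inj₁ refl) (inj₂ refl) (inj₁ refl) = x≢z refl
pigeonhole _ _ y≢z (inj₁ refl) (inj₂ refl) (inj₂ refl) = y≢z refl
pigeonhole _ _ y≢z (inj₂ refl) (inj₁ refl) (inj₁ refl) = y≢z refl
pigeonhole _ x≢z _ (inj₂ refl) (inj₁ refl) (inj₂ refl) = x≢z refl

∈-pair : ∀ {A : Set} {x a b : A} → x ∈ a ∷ b ∷ [] → x ≡ a ⊎ x ≡ b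
∈-pair (here x≡a) = inj₁ x≡a
∈-pair (there (here x≡b)) = inj₂ x≡b

unique-length≤2 : ∀ {A : Set} {P Q : A} {xs : List A} → Unique xs →
  All (λ x → x ≡ P ⊎ x ≡ Q) xs → length xs ≤ 2
unique-length≤2 _ [] = z≤n
unique-length≤2 _ (_ ∷ []) = s≤s z≤n
unique-length≤2 _ (_ ∷ _ ∷ []) = ≤-refl
unique-length≤2 ((x≢y ∷ x≢z ∷ _) ∷ (y≢z ∷ _) ∷ _) (px ∷ py ∷ pz ∷ _) =
  ⊥-elim (pigeonhole x≢y x≢z y≢z px py pz)

length≤2⇒¬three-distinct : ∀ {A : Set} {xs : List A} {x y z : A} → length xs ≤ 2 →
  x ∈ xs → y ∈ xs → z ∈ xs → x ≢ y → x ≢ z → y ≢ z → ⊥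
length≤2⇒¬three-distinct {xs = _ ∷ []} _ (here refl) (here refl) _ x≢y _ _ = x≢y refl
length≤2⇒¬three-distinct {xs = _ ∷ _ ∷ []} _ x∈ y∈ z∈ x≢y x≢z y≢z =
  pigeonhole x≢y x≢z y≢z (∈-pair x∈) (∈-pair y∈) (∈-pair z∈)
length≤2⇒¬three-distinct {xs = _ ∷ _ ∷ _ ∷ _} (s≤s (s≤s ()))

two-distinct : ∀ {A : Set} {xs : List A} → Unique xs → 2 ≤ length xs →
  ∃₂ λ x y → x ≢ y × x ∈ xs × y ∈ xs
two-distinct ((x≢y ∷ _) ∷ _) (s≤s (s≤s _)) = _ , _ , x≢y , here refl , there (here refl)

∈⇒≤sum : ∀ {A : Set} (h : A → ℕ) {x} {xs : List A} → x ∈ xs → h x ≤ sum (map h xs)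
∈⇒≤sum h (here refl) = m≤m+n _ _
∈⇒≤sum h {xs = y ∷ _} (there x∈) = ≤-trans (∈⇒≤sum h x∈) (m≤n+m _ (h y))

pair≤sum : ∀ {A : Set} (h : A → ℕ) {x y} {xs : List A} → x ∈ xs → y ∈ xs → x ≢ y →
  h x + h y ≤ sum (map h xs)
pair≤sum h (here refl) (here refl) x≢y = contradiction refl x≢y
pair≤sum h (here refl) (there y∈) _ = +-monoʳ-≤ (h _) (∈⇒≤sum h y∈)
pair≤sum h {x} {y} (there x∈) (here refl) _ =
  ≤-trans (≤-reflexive (+-comm (h x) (h y))) (+-monoʳ-≤ (h y) (∈⇒≤sum h x∈))
pair≤sum h {xs = z ∷ _} (there x∈) (there y∈) x≢y = ≤-trans (pair≤sum h x∈ y∈ x≢y) (m≤n+m _ (h z))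

length≤sum : ∀ {A : Set} (h : A → ℕ) {xs : List A} → All (λ x → 1 ≤ h x) xs → length xs ≤ sum (map h xs)
length≤sum h [] = z≤n
length≤sum h (1≤hx ∷ rest) = +-mono-≤ 1≤hx (length≤sum h rest)

sum-complement : ∀ {A : Set} m (g : A → ℕ) (xs : List A) → All (λ x → g x ≤ m) xs →
  sum (map g xs) + sum (map (λ x → m ∸ g x) xs) ≡ m * length xs
sum-complement m g [] [] = sym (*-zeroʳ m)
sum-complement m g (x ∷ xs) (gx≤m ∷ rest) = begin
  (g x + sum (map g xs)) + ((m ∸ g x) + sum (map (λ x → m ∸ g x) xs))
    ≡⟨ interchange +-commutativeSemigroup (g x) _ (m ∸ g x) _ ⟩
  (g x + (m ∸ g x)) + (sum (map g xs) + sum (map (λ x → m ∸ g x) xs))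
    ≡⟨ cong₂ _+_ (m+[n∸m]≡n gx≤m) (sum-complement m g xs rest) ⟩
  m + m * length xs
    ≡⟨ *-suc m (length xs) ⟨
  m * suc (length xs) ∎
  where open ≡-Reasoning

length-filter-∪ : ∀ {A : Set} {P Q : A → Set} (P? : Decidable P) (Q? : Decidable Q) xs →
  length (filter (P? ∪? Q?) xs) ≤ length (filter P? xs) + length (filter Q? xs)
length-filter-∪ P? Q? [] = z≤n
length-filter-∪ P? Q? (x ∷ xs) with ih ← length-filter-∪ P? Q? xs | does (P? x) | does (Q? x)
... | true  | true  = s≤s (≤-trans ih (+-monoʳ-≤ _ (n≤1+n _)))
... | true  | false = s≤s ih
... | false | true  = ≤-trans (s≤s ih) (≤-reflexive (sym (+-suc _ _)))
... | false | false = ih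

module _ {X Y : Set} {R : X → Y → Set} (R? : ∀ x y → Dec (R x y)) where

  count-any≤sum : ∀ (ys : List Y) (xs : List X) →
    length (filter (λ x → any? (R? x) ys) xs) ≤ sum (map (λ y → length (filter (λ x → R? x y) xs)) ys)
  count-any≤sum [] xs = ≤-reflexive (cong length (filter-none _ (All.universal (λ _ ()) xs)))
  count-any≤sum (y ∷ ys) xs = begin
    length (filter (λ x → any? (R? x) (y ∷ ys)) xs)
      ≡⟨ cong length (filter-≐ _ _ (toSum , fromSum) xs) ⟩
    length (filter ((λ x → R? x y) ∪? (λ x → any? (R? x) ys)) xs)
      ≤⟨ length-filter-∪ _ _ xs ⟩
    length (filter (λ x → R? x y) xs) + length (filter (λ x → any? (R? x) ys) xs)
      ≤⟨ +-monoʳ-≤ _ (count-any≤sum ys xs) ⟩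
    _ ∎
    where open ≤-Reasoning

_≟ᵥ_ : ∀ {n} (u v : Vertex n) → Dec (u ≡ v)
_≟ᵥ_ = ≡-dec Bool._≟_

EdgeIn-∈ : ∀ {n} (C : Subgraph n) {a b} → EdgeIn (edges C) a b → a ∈ verts C × b ∈ verts C
EdgeIn-∈ C (inj₁ ab∈E) = All.lookup (edges-in C) ab∈E
EdgeIn-∈ C (inj₂ ba∈E) = swap (All.lookup (edges-in C) ba∈E)

EdgeIn-FQAdj : ∀ {n} (C : Subgraph n) {a b} → EdgeIn (edges C) a b → FQAdj a b
EdgeIn-FQAdj C (inj₁ ab∈E) = All.lookup (edges-FQ C) ab∈E
EdgeIn-FQAdj C (inj₂ ba∈E) = FQAdj-sym (All.lookup (edges-FQ C) ba∈E)

first-edge : ∀ {n} {E : List (Vertex n × Vertex n)} {x y} → x ≢ y → Reach E x y → ∃ λ w → EdgeIn E x w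
first-edge x≢y here = contradiction refl x≢y
first-edge _ (step e _) = _ , e

-- The deficiencies 2 ∸ g sum to at least 2: either some vertex has weight 0, or
-- no vertex has weight 2 (it has a neighbour) and every deficiency is positive.
module ConnectedWeighting {n} (C : Subgraph n) (g : Vertex n → ℕ)
  (g≤2 : ∀ {c} → c ∈ verts C → g c ≤ 2)
  (saturated-edge : ∀ {a b} → EdgeIn (edges C) a b → g a ≡ 2 → g b ≡ 0)
  (loopless : ∀ {a} → (a , a) ∉ edges C)
  (connected : Connected C) (k≥2 : 2 ≤ length (verts C)) where

  private
    V : List (Vertex n)
    V = verts C

    E : List (Vertex n × Vertex n)
    E = edges C

  deficiency : Vertex n → ℕ
  deficiency c = 2 ∸ g c

  has-neighbour : ∀ {x} → x ∈ V → ∃ λ y → EdgeIn E x y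
  has-neighbour {x} x∈V with two-distinct (verts-unique C) k≥2
  ... | y₁ , y₂ , y₁≢y₂ , y₁∈V , y₂∈V with x ≟ᵥ y₁
  ...   | yes refl = first-edge y₁≢y₂ (connected x∈V y₂∈V)
  ...   | no x≢y₁ = first-edge x≢y₁ (connected x∈V y₁∈V)

  deficient : ∀ {x} → x ∈ V → g x ≢ 2 → 1 ≤ deficiency x
  deficient x∈V gx≢2 = m<n⇒0<n∸m (≤∧≢⇒< (g≤2 x∈V) gx≢2)

  edge-deficient : ∀ {a b} → EdgeIn E a b → 1 ≤ deficiency a ⊎ 1 ≤ deficiency b
  edge-deficient {a} ab with g a ≟ 2
  ... | yes ga≡2 = inj₂ (subst (λ t → 1 ≤ 2 ∸ t) (sym (saturated-edge ab ga≡2)) (s≤s z≤n))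
  ... | no ga≢2 = inj₁ (deficient (proj₁ (EdgeIn-∈ C ab)) ga≢2)

  no-zero⇒deficient : ¬ Any (λ c → g c ≡ 0) V → All (λ c → 1 ≤ deficiency c) V
  no-zero⇒deficient ¬zero = All.tabulate λ x∈V → deficient x∈V λ gx≡2 →
    let y , xy = has-neighbour x∈V in
    All.lookup (¬Any⇒All¬ V ¬zero) (proj₂ (EdgeIn-∈ C xy)) (saturated-edge xy gx≡2)

  2≤Σdeficiency : 2 ≤ sum (map deficiency V)
  2≤Σdeficiency with any? (λ c → g c ≟ 0) V
  ... | yes some-zero = let x , x∈V , gx≡0 = find some-zero in
                   subst (λ t → 2 ∸ t ≤ sum (map deficiency V)) gx≡0 (∈⇒≤sum deficiency x∈V)
  ... | no no-zero = ≤-trans k≥2 (length≤sum deficiency (no-zero⇒deficient no-zero))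

  Incident : Vertex n → Vertex n × Vertex n → Set
  Incident x (a , b) = a ≡ x ⊎ b ≡ x

  star-at : ∀ {x} → x ∈ V → All (Incident x) E → IsStar C
  star-at {x} x∈V incident = x , x∈V , incident , spoke
    where
      toward : ∀ {y w} → y ≢ x → EdgeIn E y w → EdgeIn E x y
      toward y≢x (inj₁ yw∈E) =
        [ ⊥-elim ∘ y≢x , (λ w≡x → inj₂ (subst (λ t → (_ , t) ∈ E) w≡x yw∈E)) ]′ (All.lookup incident yw∈E)
      toward y≢x (inj₂ wy∈E) =
        [ (λ w≡x → inj₁ (subst (λ t → (t , _) ∈ E) w≡x wy∈E)) , ⊥-elim ∘ y≢x ]′ (All.lookup incident wy∈E)

      spoke : ∀ {y} → y ∈ V → y ≢ x → EdgeIn E x y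
      spoke y∈V y≢x = toward y≢x (proj₂ (first-edge y≢x (connected y∈V x∈V)))

  incident-unless : ∀ {x} → (∀ {a b} → (a , b) ∈ E → a ≢ x → b ≢ x → ⊥) → All (Incident x) E
  incident-unless {x} avoid = All.tabulate λ { {a , b} ab∈E → incident ab∈E (a ≟ᵥ x) (b ≟ᵥ x) }
    where
      incident : ∀ {a b} → (a , b) ∈ E → Dec (a ≡ x) → Dec (b ≡ x) → Incident x (a , b)
      incident _ (yes a≡x) _ = inj₁ a≡x
      incident _ (no _) (yes b≡x) = inj₂ b≡x
      incident ab∈E (no a≢x) (no b≢x) = ⊥-elim (avoid ab∈E a≢x b≢x)

  Σdeficiency≤2⇒IsStar : sum (map deficiency V) ≤ 2 → IsStar C
  Σdeficiency≤2⇒IsStar Σ≤2 with any? (λ c → g c ≟ 0) V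
  ... | yes some-zero = let x , x∈V , gx≡0 = find some-zero in star-at x∈V (incident-unless (excess x∈V gx≡0))
    where
      excess : ∀ {x a b} → x ∈ V → g x ≡ 0 → (a , b) ∈ E → a ≢ x → b ≢ x → ⊥
      excess {x} {a} {b} x∈V gx≡0 ab∈E a≢x b≢x = [ beyond a≢x (proj₁ ab∈V) , beyond b≢x (proj₂ ab∈V) ]′
                                                   (edge-deficient (inj₁ ab∈E))
        where
          ab∈V : a ∈ V × b ∈ V
          ab∈V = EdgeIn-∈ C (inj₁ ab∈E)
          beyond : ∀ {w} → w ≢ x → w ∈ V → 1 ≤ deficiency w → ⊥
          beyond w≢x w∈V 1≤dw = ≤⇒≯ Σ≤2 (≤-trans (+-mono-≤ (≤-reflexive (cong (2 ∸_) (sym gx≡0))) 1≤dw)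
                                                  (pair≤sum deficiency x∈V w∈V (w≢x ∘ sym)))
  ... | no no-zero = let x , _ , _ , x∈V , _ = two-distinct (verts-unique C) k≥2 in
                   star-at x∈V (incident-unless (third-vertex x∈V))
    where
      k≤2 : length V ≤ 2
      k≤2 = ≤-trans (length≤sum deficiency (no-zero⇒deficient no-zero)) Σ≤2
      third-vertex : ∀ {x a b} → x ∈ V → (a , b) ∈ E → a ≢ x → b ≢ x → ⊥
      third-vertex x∈V ab∈E a≢x b≢x =
        length≤2⇒¬three-distinct k≤2 x∈V (proj₁ (EdgeIn-∈ C (inj₁ ab∈E))) (proj₂ (EdgeIn-∈ C (inj₁ ab∈E)))
          (a≢x ∘ sym) (b≢x ∘ sym) (λ { refl → loopless ab∈E })

  Σweight+Σdeficiency : sum (map g V) + sum (map deficiency V) ≡ 2 * length V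
  Σweight+Σdeficiency = sum-complement 2 g V (All.tabulate g≤2)

  Σweight≡ : sum (map g V) ≡ 2 * length V ∸ sum (map deficiency V)
  Σweight≡ = trans (sym (m+n∸n≡m (sum (map g V)) (sum (map deficiency V)))) (cong (_∸ sum (map deficiency V)) Σweight+Σdeficiency)

  weight-bound : sum (map g V) ≤ 2 * (length V ∸ 1)
  weight-bound = begin
    sum (map g V)                          ≡⟨ Σweight≡ ⟩
    2 * length V ∸ sum (map deficiency V)  ≤⟨ ∸-monoʳ-≤ (2 * length V) 2≤Σdeficiency ⟩
    2 * length V ∸ 2                       ≡⟨ *-distribˡ-∸ 2 (length V) 1 ⟨
    2 * (length V ∸ 1)                     ∎
    where open ≤-Reasoning

  tight-weight⇒IsStar : 2 * (length V ∸ 1) ≤ sum (map g V) → IsStar C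
  tight-weight⇒IsStar tight = Σdeficiency≤2⇒IsStar (∸-cancelʳ-≤ Σd≤2k (begin
    2 * length V ∸ 2                       ≡⟨ *-distribˡ-∸ 2 (length V) 1 ⟨
    2 * (length V ∸ 1)                     ≤⟨ tight ⟩
    sum (map g V)                          ≡⟨ Σweight≡ ⟩
    2 * length V ∸ sum (map deficiency V)  ∎))
    where
      open ≤-Reasoning
      Σd≤2k : sum (map deficiency V) ≤ 2 * length V
      Σd≤2k = ≤-trans (m≤n+m _ (sum (map g V))) (≤-reflexive Σweight+Σdeficiency)

-- Neighbours of a star

module StarNeighbourhood {n r} (n≥5 : 5 ≤ n) (S : StarSubgraph n r) where
  open StarSubgraph S

  leafDegree : Vertex n → ℕ
  leafDegree c = length (filter (λ s → FQAdj? s c) leaves)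

  starDegree : Vertex n → ℕ
  starDegree c = length (filter (λ s → FQAdj? s c) (starVertices S))

  private
    n≥4 : 4 ≤ n
    n≥4 = ≤-trans (n≤1+n 4) n≥5

    n≥3 : 3 ≤ n
    n≥3 = ≤-trans (n≤1+n 3) n≥4

    centre≢ : ∀ {c} → c ∉ starVertices S → centre ≢ c
    centre≢ c∉S refl = c∉S (here refl)

    leaf≢ : ∀ {c l} → c ∉ starVertices S → l ∈ leaves → l ≢ c
    leaf≢ c∉S l∈L refl = c∉S (there l∈L)

    adj : ∀ {l} → l ∈ leaves → FQAdj centre l
    adj = All.lookup leaves-adj

  leafDegree-centre-nbr : ∀ {c} → FQAdj centre c → leafDegree c ≡ 0
  leafDegree-centre-nbr {c} c₀~c = cong length (filter-none (λ s → FQAdj? s c)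
    (All.tabulate λ l∈L l~c → triangle-free n≥3 (adj l∈L) l~c (FQAdj-sym c₀~c)))

  starDegree-centre-nbr : ∀ {c} → FQAdj centre c → starDegree c ≡ 1
  starDegree-centre-nbr c₀~c =
    trans (cong length (filter-accept (λ s → FQAdj? s _) c₀~c)) (cong suc (leafDegree-centre-nbr c₀~c))

  starDegree-non-nbr : ∀ {c} → ¬ FQAdj centre c → starDegree c ≡ leafDegree c
  starDegree-non-nbr ¬c₀~c = cong length (filter-reject (λ s → FQAdj? s _) ¬c₀~c)

  leafDegree≤2 : ∀ {c} → centre ≢ c → leafDegree c ≤ 2
  leafDegree≤2 c₀≢c with common-neighbours n≥4 c₀≢c
  ... | P , Q , common = unique-length≤2 (filter⁺ _ leaves-unique) (All.tabulate λ m →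
          let l∈L , l~c = ∈-filter⁻ _ m in common (adj l∈L) l~c)

  starDegree≤2 : ∀ {c} → c ∉ starVertices S → starDegree c ≤ 2
  starDegree≤2 {c} c∉S with FQAdj? centre c
  ... | yes c₀~c = subst (_≤ 2) (sym (starDegree-centre-nbr c₀~c)) (s≤s z≤n)
  ... | no ¬c₀~c = subst (_≤ 2) (sym (starDegree-non-nbr ¬c₀~c)) (leafDegree≤2 (centre≢ c∉S))

  saturated⇒two-leaves : ∀ {c} → starDegree c ≡ 2 →
    ∃₂ λ l₁ l₂ → l₁ ≢ l₂ × (l₁ ∈ leaves × FQAdj l₁ c) × (l₂ ∈ leaves × FQAdj l₂ c)
  saturated⇒two-leaves {c} deg≡2 with FQAdj? centre c
  ... | yes c₀~c = contradiction (trans (sym (starDegree-centre-nbr c₀~c)) deg≡2) λ ()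
  ... | no ¬c₀~c with two-distinct (filter⁺ _ leaves-unique)
                        (≤-reflexive (sym (trans (sym (starDegree-non-nbr ¬c₀~c)) deg≡2)))
  ...   | l₁ , l₂ , l₁≢l₂ , m₁ , m₂ = l₁ , l₂ , l₁≢l₂ , ∈-filter⁻ _ m₁ , ∈-filter⁻ _ m₂

  starDegree-saturated : ∀ {c c′} → c ∉ starVertices S → c′ ∉ starVertices S →
    FQAdj c c′ → starDegree c ≡ 2 → starDegree c′ ≡ 0
  starDegree-saturated {c} {c′} c∉S c′∉S c~c′ deg≡2
    with saturated⇒two-leaves deg≡2 | FQAdj? centre c′
  ... | l₁ , l₂ , l₁≢l₂ , (l₁∈L , l₁~c) , (l₂∈L , l₂~c) | yes c₀~c′ =
    let P , Q , common = common-neighbours n≥4 (centre≢ c∉S) in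
    ⊥-elim (pigeonhole l₁≢l₂ (leaf≢ c′∉S l₁∈L) (leaf≢ c′∉S l₂∈L)
      (common (adj l₁∈L) l₁~c) (common (adj l₂∈L) l₂~c) (common c₀~c′ (FQAdj-sym c~c′)))
  ... | l₁ , _ , _ , (l₁∈L , l₁~c) , _ | no ¬c₀~c′ =
    trans (starDegree-non-nbr ¬c₀~c′) (cong length (filter-none (λ s → FQAdj? s c′) (All.tabulate λ l∈L l~c′ →
      pentagon-free n≥5 (adj l₁∈L) l₁~c c~c′ (FQAdj-sym l~c′) (FQAdj-sym (adj l∈L)))))

lemma5p4 : (n r : ℕ) → 5 ≤ n → 2 ≤ r → r ≤ n + 1 →
    (S : StarSubgraph n r) → (C : Subgraph n) →
    Avoids C (starVertices S) → Connected C → 2 ≤ length (verts C) →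
    (nbrCount (verts C) (starVertices S) ≤ 2 * (length (verts C) ∸ 1))
    × (nbrCount (verts C) (starVertices S) ≡ 2 * (length (verts C) ∸ 1) → IsStar C)
lemma5p4 n r n≥5 _ _ S C avoids connected k≥2 =
  ≤-trans count≤weight weight-bound ,
  λ tight → tight-weight⇒IsStar (≤-trans (≤-reflexive (sym tight)) count≤weight)
  where
    open StarNeighbourhood n≥5 S

    outside : ∀ {c} → c ∈ verts C → c ∉ starVertices S
    outside = All.lookup avoids

    saturated-edge : ∀ {a b} → EdgeIn (edges C) a b → starDegree a ≡ 2 → starDegree b ≡ 0
    saturated-edge ab = let a∈C , b∈C = EdgeIn-∈ C ab in
      starDegree-saturated (outside a∈C) (outside b∈C) (EdgeIn-FQAdj C ab)

    loopless : ∀ {a} → (a , a) ∉ edges C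
    loopless aa∈E = FQAdj-irrefl (≤-trans (s≤s z≤n) n≥5) (All.lookup (edges-FQ C) aa∈E)

    open ConnectedWeighting C starDegree (starDegree≤2 ∘ outside) saturated-edge loopless connected k≥2

    count≤weight : nbrCount (verts C) (starVertices S) ≤ sum (map starDegree (verts C))
    count≤weight = count-any≤sum FQAdj? (verts C) (starVertices S)
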